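{- For every round $r\in\{1,\dots,\mathsf{r}\}$ there exists a set $\mathcal{E}$ of $2^{r}$ feasible brackets such that for every outcome $O\in\mathcal{B}$, $\max_{E\in\mathcal{E}}s(E,O)\ge 2^{r}-1$; that is, $S(\mathcal{E})\ge 2^r-1$.
   Context: Tournament: there are $\mathsf{t}=2^{\mathsf{r}}$ teams $\mathcal{T}=\{1,\dots,\mathsf{t}\}$ playing a single-elimination tournament with a fixed bracket of $\mathsf{r}$ rounds; round $r$ has $\mathsf{t}/2^r$ games, for $\mathsf{g}=\mathsf{t}-1$ games in total, and $r(g)$ denotes the round of game $g$. Each game $g$ has a set $\mathcal{T}(g)$ of teams that can play in it: the first-round games partition $\mathcal{T}$ into pairs; each game $g$ with $r(g)>1$ has exactly two predecessor games in round $r(g)-1$, whose winners play $g$, and $\mathcal{T}(g)$ is the union of their team sets. For $t\in\mathcal{T}(g)$ with $r(g)>1$, $\gamma^-(g,t)$ is the predecessor game of $g$ with $t\in\mathcal{T}(\gamma^-(g,t))$. A feasible bracket is a matrix $B\in\{0,1\}^{\mathsf{t}\times\mathsf{g}}$ with $\sum_t B_{t,g}=1$ for every game $g$, $B_{t,g}=1$ only if $t\in\mathcal{T}(g)$, and, if $r(g)>1$ and $B_{t,g}=1$, then $B_{t,\gamma^-(g,t)}=1$; $\mathcal{B}$ is the set of feasible brackets. Both entries and outcomes are feasible brackets. The score of entry $E$ under outcome $O$ is $s(E,O)=\sum_{t}\sum_{g}2^{r(g)-1}E_{t,g}O_{t,g}$, and $S(\mathcal{E})=\max_{E\in\mathcal{E}}s(E,O)$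 for the (random) outcome $O$. -}

module Defs where

open import Data.Nat using (ℕ; zero; suc; _+_; _*_; _∸_; _^_; _≤_; _<_)
open import Data.Sum using (_⊎_)
open import Data.Fin using (Fin; toℕ)
open import Data.Product using (Σ; _,_; proj₁; proj₂; ∃-syntax; _×_)
open import Relation.Binary.PropositionalEquality using (_≡_; _≢_)

∑ : (n : ℕ) → (Fin n → ℕ) → ℕ
∑ zero    f = 0
∑ (suc n) f = f Fin.zero + ∑ n (λ i → f (Fin.suc i))

-- Canonical bracket with R rounds and t = 2^R teams (Fin (2^R)).
-- A game is a pair (k , j) with k : Fin R (round r = k+1) and
-- j : Fin (2^(R - r)) its position within round r.
Game : ℕ → Set
Game R = Σ (Fin R) (λ k → Fin (2 ^ (R ∸ suc (toℕ k))))

Team : ℕ → Set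
Team R = Fin (2 ^ R)

round : ∀ {R} → Game R → ℕ
round (k , _) = suc (toℕ k)

pos : ∀ {R} → Game R → ℕ
pos (_ , j) = toℕ j

_∈T_ : ∀ {R} → Team R → Game R → Set
t ∈T g = (pos g * 2 ^ round g ≤ toℕ t) × (toℕ t < suc (pos g) * 2 ^ round g)

Pred : ∀ {R} → Game R → Game R → Set
Pred g' g = (suc (round g') ≡ round g) × ((pos g' ≡ 2 * pos g) ⊎ (pos g' ≡ suc (2 * pos g)))

-- A t × g matrix with (intended) entries in {0,1}.
Matrix : ℕ → Set
Matrix R = Team R → Game R → ℕ

record Feasible {R : ℕ} (B : Matrix R) : Set where
  field
    binary    : ∀ t g → B t g ≤ 1
    oneWinner : ∀ g → ∑ (2 ^ R) (λ t → B t g) ≡ 1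
    inTeams   : ∀ t g → B t g ≡ 1 → t ∈T g
    -- if r(g) > 1 and B t g = 1 then B t γ⁻(g,t) = 1, where γ⁻(g,t) is the
    -- (unique) predecessor game g' of g with t ∈ T(g').
    advance   : ∀ t g g' → Pred g' g → t ∈T g' → B t g ≡ 1 → B t g' ≡ 1

score : ∀ {R} → Matrix R → Matrix R → ℕ
score {R} E O =
  ∑ (2 ^ R) (λ t →
    ∑ R (λ k →
      ∑ (2 ^ (R ∸ suc (toℕ k))) (λ j →
        2 ^ toℕ k * E t (k , j) * O t (k , j))))

Distinct : ∀ {R} → Matrix R → Matrix R → Set
Distinct {R} A B = ∃[ t ] ∃[ g ] (A t g ≢ B t g)

{-# OPTIONS --safe #-}

-- Fix a game g of round r. Each of its 2^r teams n yields a feasible entry in which n wins every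
-- game it can play and every other game goes to its lowest team. Whatever the outcome, the actual
-- winner c of g has also won its games in all earlier rounds, and the entry of c picks exactly
-- those r games, scoring 1 + 2 + ⋯ + 2^(r-1) = 2^r − 1.

module Submission where

open import Defs
open import Data.Bool using (if_then_else_)
open import Data.Nat using (ℕ; zero; suc; _+_; _*_; _∸_; _^_; _≤_; _<_; z≤n; s≤s; _≟_; _≤?_; _<?_)
open import Data.Nat.Properties
open import Data.Nat.Tactic.RingSolver using (solve-∀)
open import Data.Fin using (Fin; toℕ; fromℕ<) renaming (zero to fzero; suc to fsuc)
open import Data.Fin.Properties using (toℕ-fromℕ<; toℕ-injective; toℕ<n)
open import Data.Product using (Σ; ∃; ∃-syntax; _×_; _,_; proj₁; proj₂)
open import Data.Sum using (_⊎_; inj₁; inj₂)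
open import Function using (_∘_)
open import Relation.Nullary using (Dec; does; ¬_; yes; no; contradiction)
open import Relation.Nullary.Decidable using (_×-dec_; dec-true; dec-false)
open import Relation.Binary.PropositionalEquality

indicator : {P : Set} → Dec P → ℕ
indicator d = if does d then 1 else 0

private
  variable
    P : Set

indicator≤1 : (d : Dec P) → indicator d ≤ 1
indicator≤1 (yes _) = ≤-refl
indicator≤1 (no _)  = z≤n

indicator≡1⇒ : (d : Dec P) → indicator d ≡ 1 → P
indicator≡1⇒ (yes p) _ = p

indicator-yes : (d : Dec P) → P → indicator d ≡ 1
indicator-yes d p = cong (λ b → if b then 1 else 0) (dec-true d p)

indicator-no : (d : Dec P) → ¬ P → indicator d ≡ 0
indicator-no d ¬p = cong (λ b → if b then 1 else 0) (dec-false d ¬p)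

∑-zero : ∀ n → ∑ n (λ _ → 0) ≡ 0
∑-zero zero    = refl
∑-zero (suc n) = ∑-zero n

term≤∑ : ∀ n (f : Fin n → ℕ) i → f i ≤ ∑ n f
term≤∑ (suc n) f fzero    = m≤m+n _ _
term≤∑ (suc n) f (fsuc i) = ≤-trans (term≤∑ n (f ∘ fsuc) i) (m≤n+m _ _)

∑≡1⇒∃≡1 : ∀ n (f : Fin n → ℕ) → ∑ n f ≡ 1 → ∃ λ i → f i ≡ 1
∑≡1⇒∃≡1 (suc n) f e with f fzero in f0
... | 0 = let i , fi≡1 = ∑≡1⇒∃≡1 n (f ∘ fsuc) e in fsuc i , fi≡1
... | 1 = fzero , f0
... | suc (suc _) = contradiction e λ ()

∑-indicator : ∀ n m → m < n → ∑ n (λ i → indicator (toℕ i ≟ m)) ≡ 1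
∑-indicator (suc n) zero    _         = cong suc (∑-zero n)
∑-indicator (suc n) (suc m) (s≤s m<n) = ∑-indicator n m m<n

2^r∸1≤∑ : ∀ n r (h : Fin n → ℕ) → r ≤ n → (∀ k → toℕ k < r → 2 ^ toℕ k ≤ h k) →
  2 ^ r ∸ 1 ≤ ∑ n h
2^r∸1≤∑ n r h r≤n 2^k≤h = m≤n+o⇒m∸n≤o (2 ^ r) 1
  (subst (_≤ 1 + ∑ n h) (*-identityˡ (2 ^ r))
    (scaled n r h 1 r≤n (λ k k<r → subst (_≤ h k) (sym (*-identityˡ _)) (2^k≤h k k<r))))
  where
  -- the geometric sum m (1 + 2 + ⋯ + 2^(r-1)) = m 2^r − m, by induction on r with m doubled
  scaled : ∀ n r (h : Fin n → ℕ) m → r ≤ n → (∀ k → toℕ k < r → m * 2 ^ toℕ k ≤ h k) →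
    m * 2 ^ r ≤ m + ∑ n h
  scaled n zero h m _ _ = ≤-trans (≤-reflexive (*-identityʳ m)) (m≤m+n m _)
  scaled (suc n) (suc r) h m (s≤s r≤n) m2^k≤h = begin
    m * (2 * 2 ^ r)  ≡⟨ *-assoc m 2 (2 ^ r) ⟨
    m * 2 * 2 ^ r    ≤⟨ scaled n r (h ∘ fsuc) (m * 2) r≤n below-rest ⟩
    m * 2 + rest     ≡⟨ double m rest ⟩
    m + (m + rest)   ≤⟨ +-monoʳ-≤ m (+-monoˡ-≤ rest below-first) ⟩
    m + (h fzero + rest) ∎
    where
    open ≤-Reasoning
    rest = ∑ n (h ∘ fsuc)
    double : ∀ m s → m * 2 + s ≡ m + (m + s)
    double = solve-∀
    below-first : m ≤ h fzero
    below-first = subst (_≤ h fzero) (*-identityʳ m) (m2^k≤h fzero (s≤s z≤n))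
    below-rest : ∀ k → toℕ k < r → m * 2 * 2 ^ toℕ k ≤ h (fsuc k)
    below-rest k k<r = subst (_≤ h (fsuc k)) (sym (*-assoc m 2 _)) (m2^k≤h (fsuc k) (s≤s k<r))

InBlock : (p a x : ℕ) → Set
InBlock p a x = a * p ≤ x × x < suc a * p

InBlock? : ∀ p a x → Dec (InBlock p a x)
InBlock? p a x = (a * p ≤? x) ×-dec (x <? suc a * p)

Child : ℕ → ℕ → Set
Child a b = a ≡ 2 * b ⊎ a ≡ suc (2 * b)

InBlock-+ : ∀ {p i} a → i < p → InBlock p a (a * p + i)
InBlock-+ {p} {i} a i<p = m≤m+n (a * p) i , subst (a * p + i <_) (+-comm (a * p) p) (+-monoʳ-< (a * p) i<p)

InBlock-first : ∀ {p} a → 0 < p → InBlock p a (a * p)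
InBlock-first {p} a p>0 = ≤-refl , m<n+m (a * p) p>0

InBlock-offset : ∀ {p a x} → InBlock p a x → x ∸ a * p < p
InBlock-offset {p} {a} {x} (lo , hi) = subst (x ∸ a * p <_) (m+n∸n≡m p (a * p)) (∸-monoˡ-< hi lo)

InBlock-index-≤ : ∀ {p a b x} → InBlock p a x → InBlock p b x → a ≤ b
InBlock-index-≤ {p} (a*p≤x , _) (_ , x<[1+b]*p) =
  ≮⇒≥ λ b<a → <-irrefl refl (<-≤-trans x<[1+b]*p (≤-trans (*-monoˡ-≤ p b<a) a*p≤x))

InBlock-unique : ∀ {p a b x} → InBlock p a x → InBlock p b x → a ≡ b
InBlock-unique x∈a x∈b = ≤-antisym (InBlock-index-≤ x∈a x∈b) (InBlock-index-≤ x∈b x∈a)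

-- a block of length 2p is the union of the blocks 2b and 2b+1 of length p
left-half : ∀ b p → b * (2 * p) ≡ 2 * b * p
left-half = solve-∀

right-half : ∀ b p → suc b * (2 * p) ≡ suc (suc (2 * b)) * p
right-half = solve-∀

InBlock-parent : ∀ {p a b x} → Child a b → InBlock p a x → InBlock (2 * p) b x
InBlock-parent {p} {b = b} {x} (inj₁ refl) (lo , hi) =
  subst (_≤ x) (sym (left-half b p)) lo ,
  ≤-trans hi (subst (suc (2 * b) * p ≤_) (sym (right-half b p)) (*-monoˡ-≤ p (n≤1+n (suc (2 * b)))))
InBlock-parent {p} {b = b} {x} (inj₂ refl) (lo , hi) =
  ≤-trans (subst (_≤ suc (2 * b) * p) (sym (left-half b p)) (*-monoˡ-≤ p (n≤1+n (2 * b)))) lo ,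
  subst (x <_) (sym (right-half b p)) hi

InBlock-child : ∀ {p b x} → InBlock (2 * p) b x → ∃ λ a → Child a b × InBlock p a x
InBlock-child {p} {b} {x} (lo , hi) with x <? suc (2 * b) * p
... | yes x<  = 2 * b , inj₁ refl , subst (_≤ x) (left-half b p) lo , x<
... | no  x≮ = suc (2 * b) , inj₂ refl , ≮⇒≥ x≮ , subst (x <_) (right-half b p) hi

Child-< : ∀ {a b m} → Child a b → b < m → a < 2 * m
Child-< {b = b} {m} c b<m = ≤-trans (s≤s (bound c)) (subst (_≤ 2 * m) (*-suc 2 b) (*-monoʳ-≤ 2 b<m))
  where
  bound : ∀ {a} → Child a b → a ≤ suc (2 * b)
  bound (inj₁ refl) = n≤1+n _
  bound (inj₂ refl) = ≤-refl

InBlock-same-start : ∀ {p a b} → 0 < p → InBlock p a (b * (2 * p)) → a * p ≡ b * (2 * p)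
InBlock-same-start {p} {a} {b} p>0 x∈a = begin
  a * p         ≡⟨ cong (_* p) (InBlock-unique {p} {a} {2 * b} x∈a x∈2b) ⟩
  2 * b * p     ≡⟨ left-half b p ⟨
  b * (2 * p)   ∎
  where
  open ≡-Reasoning
  x∈2b : InBlock p (2 * b) (b * (2 * p))
  x∈2b = subst (InBlock p (2 * b)) (sym (left-half b p)) (InBlock-first {p} (2 * b) p>0)

module _ {R : ℕ} where

  _∈ᴳ_ : ℕ → Game R → Set
  x ∈ᴳ g = InBlock (2 ^ round g) (pos g) x

  _∈ᴳ?_ : ∀ x g → Dec (x ∈ᴳ g)
  x ∈ᴳ? g = InBlock? (2 ^ round g) (pos g) x

  first : Game R → ℕ
  first g = pos g * 2 ^ round g

  first-∈ᴳ : ∀ g → first g ∈ᴳ g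
  first-∈ᴳ g = InBlock-first (pos g) (m^n>0 2 (round g))

  ∈ᴳ⇒<2^R : ∀ {x} g → x ∈ᴳ g → x < 2 ^ R
  ∈ᴳ⇒<2^R {x} (k , j) (_ , x<) = begin-strict
    x                                          <⟨ x< ⟩
    suc (toℕ j) * 2 ^ suc (toℕ k)              ≤⟨ *-monoˡ-≤ (2 ^ suc (toℕ k)) (toℕ<n j) ⟩
    2 ^ (R ∸ suc (toℕ k)) * 2 ^ suc (toℕ k)    ≡⟨ ^-distribˡ-+-* 2 (R ∸ suc (toℕ k)) (suc (toℕ k)) ⟨
    2 ^ (R ∸ suc (toℕ k) + suc (toℕ k))        ≡⟨ cong (2 ^_) (m∸n+n≡m (toℕ<n k)) ⟩
    2 ^ R                                      ∎
    where open ≤-Reasoning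

  module _ {g′ g : Game R} (pred : Pred g′ g) where

    Pred⇒size : 2 ^ round g ≡ 2 * 2 ^ round g′
    Pred⇒size = cong (2 ^_) (sym (proj₁ pred))

    ∈ᴳ-Pred : ∀ {x} → x ∈ᴳ g′ → x ∈ᴳ g
    ∈ᴳ-Pred {x} x∈ = subst (λ P → InBlock P (pos g) x) (sym Pred⇒size)
      (InBlock-parent {2 ^ round g′} {pos g′} {pos g} (proj₂ pred) x∈)

    first-Pred : first g ∈ᴳ g′ → first g′ ≡ first g
    first-Pred first∈ = begin
      pos g′ * 2 ^ round g′          ≡⟨ InBlock-same-start {a = pos g′} {pos g} (m^n>0 2 (round g′)) first∈′ ⟩
      pos g * (2 * 2 ^ round g′)     ≡⟨ cong (pos g *_) Pred⇒size ⟨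
      pos g * 2 ^ round g            ∎
      where
      open ≡-Reasoning
      first∈′ : InBlock (2 ^ round g′) (pos g′) (pos g * (2 * 2 ^ round g′))
      first∈′ = subst (λ P → InBlock (2 ^ round g′) (pos g′) (pos g * P)) Pred⇒size first∈

  pick : ℕ → Game R → ℕ
  pick n g with n ∈ᴳ? g
  ... | yes _ = n
  ... | no  _ = first g

  pick-∈ᴳ : ∀ n g → pick n g ∈ᴳ g
  pick-∈ᴳ n g with n ∈ᴳ? g
  ... | yes n∈ = n∈
  ... | no  _  = first-∈ᴳ g

  pick-self : ∀ {n} g → n ∈ᴳ g → pick n g ≡ n
  pick-self {n} g n∈ with n ∈ᴳ? g
  ... | yes _  = refl
  ... | no  n∉ = contradiction n∈ n∉

  pick-Pred : ∀ n {g′ g} → Pred g′ g → pick n g ∈ᴳ g′ → pick n g′ ≡ pick n g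
  pick-Pred n {g′} {g} pred p∈ with n ∈ᴳ? g
  ... | yes _  = pick-self g′ p∈
  ... | no  n∉ with n ∈ᴳ? g′
  ...   | yes n∈′ = contradiction (∈ᴳ-Pred {g′} {g} pred n∈′) n∉
  ...   | no  _   = first-Pred {g′} {g} pred p∈

  entry : ℕ → Matrix R
  entry n t g = indicator (toℕ t ≟ pick n g)

  entry-feasible : ∀ n → Feasible (entry n)
  entry-feasible n = record
    { binary    = λ t g → indicator≤1 (toℕ t ≟ pick n g)
    ; oneWinner = λ g → ∑-indicator (2 ^ R) (pick n g) (∈ᴳ⇒<2^R g (pick-∈ᴳ n g))
    ; inTeams   = λ t g won → subst (_∈ᴳ g) (sym (wins t g won)) (pick-∈ᴳ n g)
    ; advance   = λ t g g′ pred t∈ won →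
        let t≡w = wins t g won in
        indicator-yes (toℕ t ≟ pick n g′)
          (trans t≡w (sym (pick-Pred n {g′} {g} pred (subst (_∈ᴳ g′) t≡w t∈))))
    }
    where
    wins : ∀ t g → entry n t g ≡ 1 → toℕ t ≡ pick n g
    wins t g = indicator≡1⇒ (toℕ t ≟ pick n g)

  entry-distinct : ∀ {n m} g → n ∈ᴳ g → m ∈ᴳ g → n ≢ m → Distinct (entry n) (entry m)
  entry-distinct {n} {m} g n∈ m∈ n≢m = t , g , λ eq → 1≢0 (trans (sym n-wins) (trans eq m-loses))
    where
    n< = ∈ᴳ⇒<2^R g n∈
    t : Team R
    t = fromℕ< n<
    n-wins : entry n t g ≡ 1
    n-wins = indicator-yes (toℕ t ≟ pick n g) (trans (toℕ-fromℕ< n<) (sym (pick-self g n∈)))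
    m-loses : entry m t g ≡ 0
    m-loses = indicator-no (toℕ t ≟ pick m g)
      (λ e → n≢m (trans (sym (toℕ-fromℕ< n<)) (trans e (pick-self g m∈))))
    1≢0 : 1 ≢ 0
    1≢0 ()

  ∈ᴳ-predecessor : ∀ {x} k′ k (j : Fin (2 ^ (R ∸ suc (toℕ k)))) → suc (toℕ k′) ≡ toℕ k →
    x ∈ᴳ (k , j) → ∃ λ j′ → Pred (k′ , j′) (k , j) × x ∈ᴳ (k′ , j′)
  ∈ᴳ-predecessor {x} k′ k j k′+1≡k x∈ =
    half (InBlock-child {p} {toℕ j} (subst (λ P → InBlock P (toℕ j) x) size x∈))
    where
    p = 2 ^ suc (toℕ k′)
    size : 2 ^ suc (toℕ k) ≡ 2 * p
    size = cong (λ i → 2 ^ suc i) (sym k′+1≡k)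
    count : 2 ^ (R ∸ suc (toℕ k′)) ≡ 2 * 2 ^ (R ∸ suc (toℕ k))
    count = trans (cong (λ i → 2 ^ (R ∸ i)) k′+1≡k) (cong (2 ^_) (+-∸-assoc 1 (toℕ<n k)))
    half : (∃ λ a → Child a (toℕ j) × InBlock p a x) → ∃ λ j′ → Pred (k′ , j′) (k , j) × x ∈ᴳ (k′ , j′)
    half (a , child , x∈a) =
      fromℕ< a< ,
      (cong suc k′+1≡k , subst (λ i → Child i (toℕ j)) (sym toℕ-j′) child) ,
      subst (λ i → InBlock p i x) (sym toℕ-j′) x∈a
      where
      a< : a < 2 ^ (R ∸ suc (toℕ k′))
      a< = subst (a <_) (sym count) (Child-< child (toℕ<n j))
      toℕ-j′ : toℕ (fromℕ< a<) ≡ a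
      toℕ-j′ = toℕ-fromℕ< a<

module _ {R} {O : Matrix R} (feasible : Feasible O) where
  open Feasible feasible

  wins-earlier : ∀ {c k j} → O c (k , j) ≡ 1 → ∀ k′ → toℕ k′ ≤ toℕ k → ∃ λ j′ → O c (k′ , j′) ≡ 1
  wins-earlier {c} {k} {j} won k′ k′≤k = descend (toℕ k ∸ toℕ k′) k′ (m+[n∸m]≡n k′≤k)
    where
    descend : ∀ d k′ → toℕ k′ + d ≡ toℕ k → ∃ λ j′ → O c (k′ , j′) ≡ 1
    descend zero k′ e with toℕ-injective {i = k′} {j = k} (trans (sym (+-identityʳ _)) e)
    ... | refl = j , won
    descend (suc d) k′ e = step (descend d k₁ e₁)
      where
      k′+1≤k : suc (toℕ k′) ≤ toℕ k
      k′+1≤k = subst (suc (toℕ k′) ≤_) (trans (sym (+-suc (toℕ k′) d)) e) (s≤s (m≤m+n (toℕ k′) d))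
      k′+1<R : suc (toℕ k′) < R
      k′+1<R = ≤-<-trans k′+1≤k (toℕ<n k)
      k₁ : Fin R
      k₁ = fromℕ< k′+1<R
      e₁ : toℕ k₁ + d ≡ toℕ k
      e₁ = trans (cong (_+ d) (toℕ-fromℕ< k′+1<R)) (trans (sym (+-suc (toℕ k′) d)) e)
      step : (∃ λ j₁ → O c (k₁ , j₁) ≡ 1) → ∃ λ j′ → O c (k′ , j′) ≡ 1
      step (j₁ , won₁) with ∈ᴳ-predecessor k′ k₁ j₁ (sym (toℕ-fromℕ< k′+1<R)) (inTeams c (k₁ , j₁) won₁)
      ... | j′ , pred , c∈′ = j′ , advance c (k₁ , j₁) (k′ , j′) pred c∈′ won₁

  winner-entry-score : ∀ {c g} → O c g ≡ 1 → 2 ^ round g ∸ 1 ≤ score (entry (toℕ c)) O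
  winner-entry-score {c} {k , j} won = begin
    2 ^ suc (toℕ k) ∸ 1      ≤⟨ 2^r∸1≤∑ R (suc (toℕ k)) (roundScore c) (toℕ<n k) earlier ⟩
    ∑ R (roundScore c)       ≤⟨ term≤∑ (2 ^ R) (λ t → ∑ R (roundScore t)) c ⟩
    score (entry (toℕ c)) O  ∎
    where
    open ≤-Reasoning
    roundScore : Team R → Fin R → ℕ
    roundScore t k′ =
      ∑ (2 ^ (R ∸ suc (toℕ k′))) (λ j′ → 2 ^ toℕ k′ * entry (toℕ c) t (k′ , j′) * O t (k′ , j′))
    earlier : ∀ k′ → toℕ k′ < suc (toℕ k) → 2 ^ toℕ k′ ≤ roundScore c k′
    earlier k′ (s≤s k′≤k) = reward (wins-earlier won k′ k′≤k)
      where
      reward : (∃ λ j′ → O c (k′ , j′) ≡ 1) → 2 ^ toℕ k′ ≤ roundScore c k′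
      reward (j′ , won′) = subst (_≤ roundScore c k′) term≡ (term≤∑ _ _ j′)
        where
        c-picked : entry (toℕ c) c (k′ , j′) ≡ 1
        c-picked = indicator-yes (toℕ c ≟ _) (sym (pick-self (k′ , j′) (inTeams c (k′ , j′) won′)))
        term≡ : 2 ^ toℕ k′ * entry (toℕ c) c (k′ , j′) * O c (k′ , j′) ≡ 2 ^ toℕ k′
        term≡ = trans (cong₂ (λ a b → 2 ^ toℕ k′ * a * b) c-picked won′)
                      (trans (*-identityʳ _) (*-identityʳ _))

GuaranteedPool : ℕ → ℕ → Set
GuaranteedPool R n =
  Σ (Fin (2 ^ n) → Matrix R) λ E →
    (∀ i → Feasible (E i)) ×
    (∀ i j → i ≢ j → Distinct (E i) (E j)) ×
    (∀ (O : Matrix R) → Feasible O → ∃[ i ] (2 ^ n ∸ 1 ≤ score (E i) O))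

game-pool : ∀ {R} (g : Game R) → GuaranteedPool R (round g)
game-pool {R} g = entry ∘ member , (λ _ → entry-feasible _) , distinct , covers
  where
  member : Fin (2 ^ round g) → ℕ
  member i = first g + toℕ i
  member-∈ᴳ : ∀ i → member i ∈ᴳ g
  member-∈ᴳ i = InBlock-+ (pos g) (toℕ<n i)
  distinct : ∀ i j → i ≢ j → Distinct (entry (member i)) (entry (member j))
  distinct i j i≢j =
    entry-distinct g (member-∈ᴳ i) (member-∈ᴳ j) (i≢j ∘ toℕ-injective ∘ +-cancelˡ-≡ (first g) _ _)
  covers : ∀ O → Feasible O → ∃[ i ] (2 ^ round g ∸ 1 ≤ score (entry (member i)) O)
  covers O feasible = from-winner (∑≡1⇒∃≡1 (2 ^ R) (λ t → O t g) (Feasible.oneWinner feasible g))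
    where
    from-winner : (∃ λ c → O c g ≡ 1) → ∃[ i ] (2 ^ round g ∸ 1 ≤ score (entry (member i)) O)
    from-winner (c , won) =
      fromℕ< offset< ,
      subst (λ n → 2 ^ round g ∸ 1 ≤ score (entry n) O) (sym member≡c) (winner-entry-score feasible won)
      where
      c∈ : toℕ c ∈ᴳ g
      c∈ = Feasible.inTeams feasible c g won
      offset< : toℕ c ∸ first g < 2 ^ round g
      offset< = InBlock-offset {a = pos g} c∈
      member≡c : member (fromℕ< offset<) ≡ toℕ c
      member≡c = trans (cong (first g +_) (toℕ-fromℕ< offset<)) (m+[n∸m]≡n (proj₁ c∈))

proposition3 : (R r : ℕ) → 1 ≤ r → r ≤ R →
    Σ (Fin (2 ^ r) → Matrix R) λ E →
      (∀ i → Feasible (E i)) ×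
      (∀ i j → i ≢ j → Distinct (E i) (E j)) ×
      (∀ (O : Matrix R) → Feasible O → ∃[ i ] (2 ^ r ∸ 1 ≤ score (E i) O))
proposition3 R zero    ()  _
proposition3 R (suc r) _   r<R =
  subst (GuaranteedPool R) (cong suc (toℕ-fromℕ< r<R))
    (game-pool (fromℕ< r<R , fromℕ< (m^n>0 2 (R ∸ suc (toℕ (fromℕ< r<R))))))
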